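{- Let $A$ be a finite set with a distinguished element $0$, let $(B;+)$ be a finite Boolean group, let $n \ge 1$ and $t \ge 1$ be integers with $n - |A| = 2t > 0$, and let $f \colon A^n \to B$. Then $f$ is determined by $\operatorname{oddsupp}$ if and only if there is a map $\varphi \colon \mathcal{P}(A) \to B$ satisfying $\varphi(S) = \varphi(S \triangle \{0\})$ for every $S \subseteq A$ such that for all $\mathbf{x} \in A^n$ \[ f(\mathbf{x}) = \sum_{i = t + 1}^{\lfloor n/2 \rfloor} \sum_{\substack{I \subseteq [n] \\ |I| = n - 2i}} \binom{i - 1}{t} \varphi(\operatorname{oddsupp}(\mathbf{x}|_I)) + \sum_{k = t + 1}^{\lfloor (n+1)/2 \rfloor} \sum_{\substack{K \subseteq [n] \\ |K| = n - 2k + 1}} \binom{2k - 1}{2t} \varphi(\operatorname{oddsupp}(\mathbf{x}|_K)). \] Moreover, such a $\varphi$ is uniquely determined by $f$.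
   Context: A Boolean group is an abelian group in which $b + b = 0$ for all $b$; an integer coefficient $m$ times an element $b$ means $b + \dots + b$ ($m$ times). $\triangle$ denotes symmetric difference of sets. $[n] = \{1,\dots,n\}$. For $\mathbf{x} \in A^n$ and $I = \{i_1 < \dots < i_k\} \subseteq [n]$, $\mathbf{x}|_I = (x_{i_1}, \dots, x_{i_k})$ (the empty tuple if $I = \emptyset$). For a tuple $(a_1,\dots,a_m)$ over $A$ ($m \ge 0$), $\operatorname{oddsupp}(a_1,\dots,a_m) = \{a \in A : |\{j : a_j = a\}| \text{ is odd}\}$ (so $\operatorname{oddsupp}$ of the empty tuple is $\emptyset$). A function $f \colon A^n \to B$ is determined by $\operatorname{oddsupp}$ if there is a map $\psi \colon \mathcal{P}(A) \to B$ with $f(\mathbf{x}) = \psi(\operatorname{oddsupp}(\mathbf{x}))$ for all $\mathbf{x} \in A^n$. -}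

module Defs where

open import Level using (Level)
open import Data.Bool using (Bool; true; false; if_then_else_; _xor_)
open import Data.Nat using (ℕ; zero; suc; _+_; _*_; _∸_; _≤_; _/_; _%_; _≡ᵇ_)
open import Data.Nat.Combinatorics using (_C_)
open import Data.Fin using (Fin; zero; suc)
open import Data.Fin.Properties using (_≟_)
open import Data.Fin.Subset using (Subset; ⁅_⁆; ∣_∣; inside; outside)
open import Data.Vec using (Vec; []; _∷_; tabulate; zipWith; toList)
open import Data.List using (List; []; _∷_; map; _++_; foldr; filterᵇ; upTo)
open import Data.Product using (Σ; _×_; ∃; _,_)
open import Relation.Nullary using (does)
open import Relation.Binary.PropositionalEquality using (_≡_)
open import Algebra.Bundles using (AbelianGroup)

count : ∀ {k} → Fin k → List (Fin k) → ℕ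
count a [] = 0
count a (b ∷ bs) = if does (a ≟ b) then suc (count a bs) else count a bs

isOdd : ℕ → Bool
isOdd m = (m % 2) ≡ᵇ 1

oddsupp : ∀ {k} → List (Fin k) → Subset k
oddsupp as = tabulate (λ a → isOdd (count a as))

restrict : ∀ {A : Set} {n} → Vec A n → Subset n → List A
restrict [] [] = []
restrict (x ∷ xs) (true ∷ I) = x ∷ restrict xs I
restrict (x ∷ xs) (false ∷ I) = restrict xs I

allSubsets : ∀ n → List (Subset n)
allSubsets zero = [] ∷ []
allSubsets (suc n) = map (outside ∷_) (allSubsets n) ++ map (inside ∷_) (allSubsets n)

subsetsOfSize : ∀ n → ℕ → List (Subset n)
subsetsOfSize n s = filterᵇ (λ I → ∣ I ∣ ≡ᵇ s) (allSubsets n)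

_△_ : ∀ {k} → Subset k → Subset k → Subset k
_△_ = zipWith _xor_

module BoolGroup {c ℓ : Level} (B : AbelianGroup c ℓ) where
  open AbelianGroup B

  IsBoolean : Set (c Level.⊔ ℓ)
  IsBoolean = ∀ b → (b ∙ b) ≈ ε

  IsFinite : Set (c Level.⊔ ℓ)
  IsFinite = Σ ℕ λ k → Σ (Fin k → Carrier) λ e → ∀ b → ∃ λ i → e i ≈ b

  _·_ : ℕ → Carrier → Carrier
  zero · b = ε
  suc m · b = b ∙ (m · b)

  sumL : List Carrier → Carrier
  sumL = foldr _∙_ ε

  -- Σ_{i = lo}^{hi} g i
  sumRange : ℕ → ℕ → (ℕ → Carrier) → Carrier
  sumRange lo hi g = sumL (map (λ j → g (lo + j)) (upTo (suc hi ∸ lo)))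

  DeterminedByOddsupp : ∀ {m n} → (Vec (Fin (suc m)) n → Carrier) → Set (c Level.⊔ ℓ)
  DeterminedByOddsupp {m} {n} f =
    Σ (Subset (suc m) → Carrier) λ ψ → ∀ x → f x ≈ ψ (oddsupp (toList x))

  Invariant0 : ∀ {m} → (Subset (suc m) → Carrier) → Set ℓ
  Invariant0 φ = ∀ S → φ S ≈ φ (S △ ⁅ zero ⁆)

  formula : ∀ {m} (n t : ℕ) → (Subset (suc m) → Carrier) → Vec (Fin (suc m)) n → Carrier
  formula n t φ x =
    sumRange (suc t) (n / 2) (λ i →
      sumL (map (λ I → ((i ∸ 1) C t) · φ (oddsupp (restrict x I)))
                (subsetsOfSize n (n ∸ 2 * i))))
    ∙
    sumRange (suc t) ((n + 1) / 2) (λ k →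
      sumL (map (λ K → ((2 * k ∸ 1) C (2 * t)) · φ (oddsupp (restrict x K)))
                (subsetsOfSize n (n + 1 ∸ 2 * k))))

-- Write the right-hand side of the formula as Σ_{I ⊆ [n]} w(n − |I|) φ(oddsupp(x|_I)) with
-- w(j) = C(j − 1, 2t) mod 2; by Lucas' theorem mod 2 this weighting is the one of the formula.
-- Splitting off the first letter a of x turns such a sum into one for the tail with shifted
-- weights plus one for the translate S ↦ φ(S △ {a}).  Hence, by induction on n, whenever the
-- weights satisfy the right Pascal-type recursions the sum equals φ(oddsupp x) for every φ
-- whose |A|-fold differences Δ_{a₁} ⋯ Δ_{a_|A|} φ (Δ_a φ(S) = φ(S) + φ(S △ {a})) all vanish.
-- A 0-invariant φ has this property: either some aᵢ is 0, and Δ₀φ = 0, or two aᵢ coincide,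
-- and Δ_a Δ_a = 0 in a Boolean group.  Conversely oddsupp x always has the parity of n, so any
-- ψ may be replaced by the 0-invariant φ that agrees with it on sets of that parity; and every
-- set is the oddsupp of some x up to the element 0, which gives uniqueness.

module Submission where

open import Defs
open import Level using (Level)
open import Data.Nat using (ℕ; suc; _+_; _*_; _≤_)
open import Data.Fin using (Fin)
open import Data.Fin.Subset using (Subset)
open import Data.Vec using (Vec)
open import Data.Product using (Σ; _×_)
open import Relation.Binary.PropositionalEquality using (_≡_)
open import Function.Bundles using (_⇔_)
open import Algebra.Bundles using (AbelianGroup)

open import Data.Bool using (Bool; true; false; not; if_then_else_; T)
open import Data.Bool.Properties using (xor-assoc; xor-comm; xor-same; xor-identityˡ; xor-identityʳ)
open import Data.Nat using (zero; _∸_; _<_; _/_; _≡ᵇ_; z≤n; s≤s; ⌊_/2⌋; ⌈_/2⌉; parity)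
open import Data.Nat.Properties
  using (+-comm; +-suc; +-identityʳ; *-suc; suc-injective; ≤-reflexive; ≤-trans; m<n⇒m<1+n; <⇒≤pred; n<1+n;
         m≤n+m; m∸[m∸n]≡n; ⌊n/2⌋-mono; ⌊n/2⌋≤⌈n/2⌉; ≡ᵇ⇒≡; ≡⇒≡ᵇ)
open import Data.Nat.DivMod using (m/n≡1+[m∸n]/n)
open import Data.Nat.Combinatorics using (_C_; k>n⇒nCk≡0; nCk+nC[k+1]≡[n+1]C[k+1])
open import Data.Parity using (Parity; 0ℙ; 1ℙ; _⁻¹)
import Data.Parity as ℙ
open import Data.Parity.Properties using (⁻¹-selfInverse; suc-homo-⁻¹; +-homo-+; p+p≡0ℙ; p⁻¹+p≡1ℙ)
import Data.Parity.Properties as ℙₚ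
open import Data.Fin using (zero; suc)
import Data.Fin as Fin
open import Data.Fin.Properties using (pigeonhole; punchOut-injective)
open import Data.Fin.Subset using (⊥; ⁅_⁆; ∣_∣; ∁; inside; outside)
open import Data.Fin.Subset.Properties using (∣⊥∣≡0; ∣p∣≤n; ∣∁p∣≡n∸∣p∣)
open import Data.List using (List; []; _∷_; _++_; map; filterᵇ; applyUpTo)
open import Data.List.Properties using (map-++; map-upTo; map-∘; filter-≐)
open import Data.Vec using ([]; _∷_; toList; tabulate; lookup; tail; replicate; insertAt)
import Data.Vec as Vec
open import Data.Vec.Properties
  using (toList-map; toList-++; tabulate-cong; map-id;
         zipWith-assoc; zipWith-comm; zipWith-identityˡ; zipWith-identityʳ; zipWith-inverseʳ)
open import Data.Vec.Membership.Propositional using (_∈_)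
open import Data.Vec.Membership.Propositional.Properties using (∈-lookup)
open import Data.Vec.Relation.Unary.Any using (here; there; any?)
open import Data.Product using (_,_; ∃₂)
open import Data.Sum using (_⊎_; inj₁; inj₂)
open import Function.Bundles using (mk⇔)
open import Relation.Nullary using (does; yes; no; ¬_)
open import Relation.Nullary.Decidable using (T?)
import Relation.Binary.PropositionalEquality as ≡

private variable k n : ℕ

module _ where
  open ≡ using (refl; sym; trans; cong; cong₂; module ≡-Reasoning)

  △-assoc : (S T U : Subset k) → (S △ T) △ U ≡ S △ (T △ U)
  △-assoc = zipWith-assoc xor-assoc

  △-comm : (S T : Subset k) → S △ T ≡ T △ S
  △-comm = zipWith-comm xor-comm

  △-identityˡ : (S : Subset k) → ⊥ △ S ≡ S
  △-identityˡ = zipWith-identityˡ xor-identityˡ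

  △-identityʳ : (S : Subset k) → S △ ⊥ ≡ S
  △-identityʳ = zipWith-identityʳ xor-identityʳ

  △-self : (S : Subset k) → S △ S ≡ ⊥
  △-self S = trans (cong (S △_) (sym (map-id S))) (zipWith-inverseʳ xor-same S)

  △-cancelʳ : (S T : Subset k) → (S △ T) △ T ≡ S
  △-cancelʳ S T = begin
    (S △ T) △ T  ≡⟨ △-assoc S T T ⟩
    S △ (T △ T)  ≡⟨ cong (S △_) (△-self T) ⟩
    S △ ⊥        ≡⟨ △-identityʳ S ⟩
    S            ∎
    where open ≡-Reasoning

  △-swapʳ : (S T U : Subset k) → (S △ T) △ U ≡ (S △ U) △ T
  △-swapʳ S T U = begin
    (S △ T) △ U  ≡⟨ △-assoc S T U ⟩
    S △ (T △ U)  ≡⟨ cong (S △_) (△-comm T U) ⟩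
    S △ (U △ T)  ≡⟨ △-assoc S U T ⟨
    (S △ U) △ T  ∎
    where open ≡-Reasoning

  oddsupp-[] : oddsupp {k} [] ≡ ⊥
  oddsupp-[] {k} = tabulate-const k
    where
    tabulate-const : ∀ j → tabulate {n = j} (λ _ → false) ≡ ⊥
    tabulate-const zero    = refl
    tabulate-const (suc j) = cong (false ∷_) (tabulate-const j)

  oddsupp-∷ : (a : Fin k) (as : List (Fin k)) → oddsupp (a ∷ as) ≡ ⁅ a ⁆ △ oddsupp as
  oddsupp-∷ a as = trans (tabulate-cong count-∷) (sym (⁅⁆△tabulate a (λ b → isOdd (count b as))))
    where
    isOdd-suc : ∀ c → isOdd (suc c) ≡ not (isOdd c)
    isOdd-suc zero          = refl
    isOdd-suc (suc zero)    = refl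
    isOdd-suc (suc (suc c)) = isOdd-suc c

    count-∷ : ∀ b → isOdd (count b (a ∷ as)) ≡ (if does (b Fin.≟ a) then not (isOdd (count b as)) else isOdd (count b as))
    count-∷ b with does (b Fin.≟ a)
    ... | true  = isOdd-suc (count b as)
    ... | false = refl

    ⁅⁆△tabulate : ∀ {j} (a : Fin j) (f : Fin j → Bool) →
      ⁅ a ⁆ △ tabulate f ≡ tabulate (λ b → if does (b Fin.≟ a) then not (f b) else f b)
    ⁅⁆△tabulate zero    f = cong (not (f zero) ∷_) (zipWith-identityˡ xor-identityˡ (tabulate (λ b → f (suc b))))
    ⁅⁆△tabulate (suc a) f = cong (f zero ∷_) (⁅⁆△tabulate a (λ b → f (suc b)))

  oddsupp-++ : (as bs : List (Fin k)) → oddsupp (as ++ bs) ≡ oddsupp as △ oddsupp bs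
  oddsupp-++ []       bs = trans (sym (△-identityˡ (oddsupp bs))) (cong (_△ oddsupp bs) (sym oddsupp-[]))
  oddsupp-++ (a ∷ as) bs = begin
    oddsupp (a ∷ as ++ bs)                 ≡⟨ oddsupp-∷ a (as ++ bs) ⟩
    ⁅ a ⁆ △ oddsupp (as ++ bs)             ≡⟨ cong (⁅ a ⁆ △_) (oddsupp-++ as bs) ⟩
    ⁅ a ⁆ △ (oddsupp as △ oddsupp bs)      ≡⟨ △-assoc ⁅ a ⁆ (oddsupp as) (oddsupp bs) ⟨
    (⁅ a ⁆ △ oddsupp as) △ oddsupp bs      ≡⟨ cong (_△ oddsupp bs) (oddsupp-∷ a as) ⟨
    oddsupp (a ∷ as) △ oddsupp bs          ∎
    where open ≡-Reasoning

  parity-∣⁅⁆△∣ : (a : Fin k) (S : Subset k) → parity ∣ ⁅ a ⁆ △ S ∣ ≡ (parity ∣ S ∣) ⁻¹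
  parity-∣⁅⁆△∣ zero    (true  ∷ R) = trans (cong (λ T → parity ∣ T ∣) (△-identityˡ R)) (sym (suc-homo-⁻¹ ∣ R ∣))
  parity-∣⁅⁆△∣ zero    (false ∷ R) = trans (cong (λ T → parity (suc ∣ T ∣)) (△-identityˡ R)) (sym (⁻¹-selfInverse (suc-homo-⁻¹ ∣ R ∣)))
  parity-∣⁅⁆△∣ (suc a) (true  ∷ R) = begin
    parity (suc ∣ ⁅ a ⁆ △ R ∣)      ≡⟨ ⁻¹-selfInverse (suc-homo-⁻¹ ∣ ⁅ a ⁆ △ R ∣) ⟨
    (parity ∣ ⁅ a ⁆ △ R ∣) ⁻¹       ≡⟨ cong _⁻¹ (parity-∣⁅⁆△∣ a R) ⟩
    (parity ∣ R ∣) ⁻¹ ⁻¹            ≡⟨ cong _⁻¹ (⁻¹-selfInverse (suc-homo-⁻¹ ∣ R ∣)) ⟩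
    (parity (suc ∣ R ∣)) ⁻¹         ∎
    where open ≡-Reasoning
  parity-∣⁅⁆△∣ (suc a) (false ∷ R) = parity-∣⁅⁆△∣ a R

  parity-∣oddsupp∣ : (x : Vec (Fin k) n) → parity ∣ oddsupp (toList x) ∣ ≡ parity n
  parity-∣oddsupp∣ {k} [] = trans (cong (λ S → parity ∣ S ∣) (oddsupp-[] {k})) (cong parity (∣⊥∣≡0 k))
  parity-∣oddsupp∣ {n = suc n} (a ∷ x) = begin
    parity ∣ oddsupp (a ∷ toList x) ∣     ≡⟨ cong (λ S → parity ∣ S ∣) (oddsupp-∷ a (toList x)) ⟩
    parity ∣ ⁅ a ⁆ △ oddsupp (toList x) ∣ ≡⟨ parity-∣⁅⁆△∣ a (oddsupp (toList x)) ⟩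
    (parity ∣ oddsupp (toList x) ∣) ⁻¹    ≡⟨ cong _⁻¹ (parity-∣oddsupp∣ x) ⟩
    (parity n) ⁻¹                         ≡⟨ ⁻¹-selfInverse (suc-homo-⁻¹ n) ⟩
    parity (suc n)                        ∎
    where open ≡-Reasoning

  -- Every set is an oddsupp, up to the element 0

  tail-△ : (S T : Subset (suc k)) → tail (S △ T) ≡ tail S △ tail T
  tail-△ (_ ∷ _) (_ ∷ _) = refl

  tail-oddsupp-zero∷ : (as : List (Fin (suc k))) → tail (oddsupp (zero ∷ as)) ≡ tail (oddsupp as)
  tail-oddsupp-zero∷ as = trans (cong tail (oddsupp-∷ zero as)) (trans (tail-△ ⁅ zero ⁆ (oddsupp as)) (△-identityˡ (tail (oddsupp as))))

  tail-oddsupp-zeros : ∀ r → tail (oddsupp (toList (replicate r (zero {n = k})))) ≡ ⊥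
  tail-oddsupp-zeros zero    = cong tail oddsupp-[]
  tail-oddsupp-zeros (suc r) = trans (tail-oddsupp-zero∷ (toList (replicate r zero))) (tail-oddsupp-zeros r)

  oddsupp-map-punchIn₁ : (as : List (Fin (suc k))) →
    oddsupp (map (Fin.punchIn (suc zero)) as) ≡ insertAt (oddsupp as) (suc zero) false
  oddsupp-map-punchIn₁ []       = trans oddsupp-[] (cong (λ S → insertAt S (suc zero) false) (sym oddsupp-[]))
  oddsupp-map-punchIn₁ (a ∷ as) = begin
    oddsupp (map (Fin.punchIn (suc zero)) (a ∷ as))
      ≡⟨ oddsupp-∷ (Fin.punchIn (suc zero) a) (map (Fin.punchIn (suc zero)) as) ⟩
    ⁅ Fin.punchIn (suc zero) a ⁆ △ oddsupp (map (Fin.punchIn (suc zero)) as)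
      ≡⟨ cong (⁅ Fin.punchIn (suc zero) a ⁆ △_) (oddsupp-map-punchIn₁ as) ⟩
    ⁅ Fin.punchIn (suc zero) a ⁆ △ insertAt (oddsupp as) (suc zero) false
      ≡⟨ ⁅punchIn⁆△insertAt a (oddsupp as) ⟩
    insertAt (⁅ a ⁆ △ oddsupp as) (suc zero) false
      ≡⟨ cong (λ S → insertAt S (suc zero) false) (oddsupp-∷ a as) ⟨
    insertAt (oddsupp (a ∷ as)) (suc zero) false ∎
    where
    open ≡-Reasoning
    ⁅punchIn⁆△insertAt : ∀ {j} (a : Fin (suc j)) (S : Subset (suc j)) →
      ⁅ Fin.punchIn (suc zero) a ⁆ △ insertAt S (suc zero) false ≡ insertAt (⁅ a ⁆ △ S) (suc zero) false
    ⁅punchIn⁆△insertAt zero    (_ ∷ _) = refl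
    ⁅punchIn⁆△insertAt (suc a) (_ ∷ _) = refl

  -- spell R has entry suc i at the positions i ∈ R and the filler zero elsewhere
  spell : Subset k → Vec (Fin (suc k)) k
  spell []      = []
  spell (b ∷ R) = (if b then suc zero else zero) ∷ Vec.map (Fin.punchIn (suc zero)) (spell R)

  tail-oddsupp-spell : (R : Subset k) → tail (oddsupp (toList (spell R))) ≡ R
  tail-oddsupp-spell []      = cong tail oddsupp-[]
  tail-oddsupp-spell {suc k} (b ∷ R) = begin
    tail (oddsupp (c ∷ toList (Vec.map p₁ (spell R))))
      ≡⟨ cong (λ as → tail (oddsupp (c ∷ as))) (toList-map p₁ (spell R)) ⟩
    tail (oddsupp (c ∷ map p₁ (toList (spell R))))
      ≡⟨ cong tail (oddsupp-∷ c (map p₁ (toList (spell R)))) ⟩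
    tail (⁅ c ⁆ △ oddsupp (map p₁ (toList (spell R))))
      ≡⟨ cong (λ S → tail (⁅ c ⁆ △ S)) (oddsupp-map-punchIn₁ (toList (spell R))) ⟩
    tail (⁅ c ⁆ △ insertAt (oddsupp (toList (spell R))) (suc zero) false)
      ≡⟨ tail-⁅⁆△insertAt b (oddsupp (toList (spell R))) ⟩
    b ∷ (⊥ △ tail (oddsupp (toList (spell R))))
      ≡⟨ cong (b ∷_) (trans (△-identityˡ _) (tail-oddsupp-spell R)) ⟩
    b ∷ R ∎
    where
    open ≡-Reasoning
    c : Fin (suc (suc k))
    c = if b then suc zero else zero
    p₁ : Fin (suc k) → Fin (suc (suc k))
    p₁ = Fin.punchIn (suc zero)

    tail-⁅⁆△insertAt : ∀ {j} b (S : Subset (suc j)) →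
      tail (⁅ (if b then suc zero else zero) ⁆ △ insertAt S (suc zero) false) ≡ b ∷ (⊥ △ tail S)
    tail-⁅⁆△insertAt true  (_ ∷ _) = refl
    tail-⁅⁆△insertAt false (_ ∷ _) = refl

  tail-oddsupp-witness : ∀ r (R : Subset k) → tail (oddsupp (toList (zero ∷ (spell R Vec.++ replicate r zero)))) ≡ R
  tail-oddsupp-witness r R = begin
    tail (oddsupp (zero ∷ toList (spell R Vec.++ replicate r zero)))
      ≡⟨ tail-oddsupp-zero∷ (toList (spell R Vec.++ replicate r zero)) ⟩
    tail (oddsupp (toList (spell R Vec.++ replicate r zero)))
      ≡⟨ cong (λ as → tail (oddsupp as)) (toList-++ (spell R) (replicate r zero)) ⟩
    tail (oddsupp (toList (spell R) ++ toList (replicate r zero)))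
      ≡⟨ cong tail (oddsupp-++ (toList (spell R)) (toList (replicate r zero))) ⟩
    tail (oddsupp (toList (spell R)) △ oddsupp (toList (replicate r zero)))
      ≡⟨ tail-△ (oddsupp (toList (spell R))) (oddsupp (toList (replicate r zero))) ⟩
    tail (oddsupp (toList (spell R))) △ tail (oddsupp (toList (replicate r zero)))
      ≡⟨ cong₂ _△_ (tail-oddsupp-spell R) (tail-oddsupp-zeros r) ⟩
    R △ ⊥
      ≡⟨ △-identityʳ R ⟩
    R ∎
    where open ≡-Reasoning

  -- Fixing the element 0 by parity

  parityBit : Parity → Bool
  parityBit 0ℙ = false
  parityBit 1ℙ = true

  head≡parityBit : ∀ b (R : Subset k) {p} → parity ∣ b ∷ R ∣ ≡ p → b ≡ parityBit (parity ∣ R ∣ ℙ.+ p)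
  head≡parityBit true  R {p} eq =
    cong parityBit (sym (trans (cong (ℙ._+ p) (trans (sym (suc-homo-⁻¹ ∣ R ∣)) (cong _⁻¹ eq))) (p⁻¹+p≡1ℙ p)))
  head≡parityBit false R {p} eq = cong parityBit (sym (trans (cong (ℙ._+ p) eq) (p+p≡0ℙ p)))

  module _ {a} {A : Set a} where

    -- ψ read off at the set of parity p with the same tail
    invariantExtension : Parity → (Subset (suc k) → A) → Subset (suc k) → A
    invariantExtension p ψ (_ ∷ R) = ψ (parityBit (parity ∣ R ∣ ℙ.+ p) ∷ R)

    invariantExtension-agrees : ∀ p ψ (S : Subset (suc k)) → parity ∣ S ∣ ≡ p → invariantExtension p ψ S ≡ ψ S
    invariantExtension-agrees p ψ (b ∷ R) eq = cong (λ b′ → ψ (b′ ∷ R)) (sym (head≡parityBit b R eq))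

    invariantExtension-△⁅0⁆ : ∀ p ψ (S : Subset (suc k)) → invariantExtension p ψ (S △ ⁅ zero ⁆) ≡ invariantExtension p ψ S
    invariantExtension-△⁅0⁆ p ψ (_ ∷ R) = cong (λ T → ψ (parityBit (parity ∣ T ∣ ℙ.+ p) ∷ T)) (△-identityʳ R)

  -- Binomial coefficients mod 2

  binom₂ : ℕ → ℕ → Parity
  binom₂ n       zero    = 1ℙ
  binom₂ zero    (suc k) = 0ℙ
  binom₂ (suc n) (suc k) = binom₂ n k ℙ.+ binom₂ n (suc k)

  parity-C : ∀ n k → parity (n C k) ≡ binom₂ n k
  parity-C n       zero    = refl
  parity-C zero    (suc k) = cong parity (k>n⇒nCk≡0 {0} {suc k} (s≤s z≤n))
  parity-C (suc n) (suc k) = begin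
    parity (suc n C suc k)                   ≡⟨ cong parity (nCk+nC[k+1]≡[n+1]C[k+1] n k) ⟨
    parity (n C k + n C suc k)               ≡⟨ +-homo-+ (n C k) (n C suc k) ⟩
    parity (n C k) ℙ.+ parity (n C suc k)    ≡⟨ cong₂ ℙ._+_ (parity-C n k) (parity-C n (suc k)) ⟩
    binom₂ n k ℙ.+ binom₂ n (suc k)          ∎
    where open ≡-Reasoning

  binom₂-< : ∀ {n k} → n < k → binom₂ n k ≡ 0ℙ
  binom₂-< {zero}  {suc k} _         = refl
  binom₂-< {suc n} {suc k} (s≤s n<k) = cong₂ ℙ._+_ (binom₂-< n<k) (binom₂-< (m<n⇒m<1+n n<k))

  -- (1 + X)² = 1 + X² over 𝔽₂
  binom₂-square : ∀ n k → binom₂ (suc (suc n)) (suc (suc k)) ≡ binom₂ n k ℙ.+ binom₂ n (suc (suc k))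
  binom₂-square n k = begin
    (a ℙ.+ b) ℙ.+ (b ℙ.+ c)   ≡⟨ ℙₚ.+-assoc a b (b ℙ.+ c) ⟩
    a ℙ.+ (b ℙ.+ (b ℙ.+ c))   ≡⟨ cong (a ℙ.+_) (ℙₚ.+-assoc b b c) ⟨
    a ℙ.+ ((b ℙ.+ b) ℙ.+ c)   ≡⟨ cong (λ z → a ℙ.+ (z ℙ.+ c)) (p+p≡0ℙ b) ⟩
    a ℙ.+ c                   ∎
    where
    open ≡-Reasoning
    a b c : Parity
    a = binom₂ n k
    b = binom₂ n (suc k)
    c = binom₂ n (suc (suc k))

  double : ℕ → ℕ
  double zero    = zero
  double (suc n) = suc (suc (double n))

  2*≡double : ∀ n → 2 * n ≡ double n
  2*≡double zero    = refl
  2*≡double (suc n) = trans (*-suc 2 n) (cong (λ m → suc (suc m)) (2*≡double n))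

  binom₂-double-odd : ∀ p q → binom₂ (double p) (suc (double q)) ≡ 0ℙ
  binom₂-double-odd zero    q       = refl
  binom₂-double-odd (suc p) zero    = cong (λ z → 1ℙ ℙ.+ (1ℙ ℙ.+ z)) (binom₂-double-odd p 0)
  binom₂-double-odd (suc p) (suc q) =
    trans (binom₂-square (double p) (suc (double q))) (cong₂ ℙ._+_ (binom₂-double-odd p q) (binom₂-double-odd p (suc q)))

  binom₂-double : ∀ p q → binom₂ (double p) (double q) ≡ binom₂ p q
  binom₂-double zero    zero    = refl
  binom₂-double zero    (suc q) = refl
  binom₂-double (suc p) zero    = refl
  binom₂-double (suc p) (suc q) =
    trans (binom₂-square (double p) (double q)) (cong₂ ℙ._+_ (binom₂-double p q) (binom₂-double p (suc q)))

  binom₂-suc-double : ∀ p q → binom₂ (suc (double p)) (double q) ≡ binom₂ p q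
  binom₂-suc-double p zero    = refl
  binom₂-suc-double p (suc q) =
    trans (cong₂ ℙ._+_ (binom₂-double-odd p q) (binom₂-double p (suc q))) (ℙₚ.+-identityˡ (binom₂ p (suc q)))

  x+[y+x]≡y : ∀ x y → x ℙ.+ (y ℙ.+ x) ≡ y
  x+[y+x]≡y 0ℙ 0ℙ = refl
  x+[y+x]≡y 0ℙ 1ℙ = refl
  x+[y+x]≡y 1ℙ 0ℙ = refl
  x+[y+x]≡y 1ℙ 1ℙ = refl

  -- C(j − 1, b) mod 2, the weight of the subsets I with j = n − |I| omitted positions
  pascalWeight : ℕ → ℕ → Parity
  pascalWeight b zero    = 0ℙ
  pascalWeight b (suc j) = binom₂ j b

  pascalWeight-double : ∀ t i → pascalWeight (2 * t) (double (suc i)) ≡ binom₂ i t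
  pascalWeight-double t i = trans (cong (binom₂ (suc (double i))) (2*≡double t)) (binom₂-suc-double i t)

  pascalWeight-suc-double : ∀ t i → pascalWeight (2 * t) (suc (double i)) ≡ binom₂ i t
  pascalWeight-suc-double t i = trans (cong (binom₂ (double i)) (2*≡double t)) (binom₂-double i t)

  parity-C-odd : ∀ i t → parity ((2 * suc i ∸ 1) C (2 * t)) ≡ binom₂ i t
  parity-C-odd i t = begin
    parity ((2 * suc i ∸ 1) C (2 * t))   ≡⟨ parity-C (2 * suc i ∸ 1) (2 * t) ⟩
    binom₂ (2 * suc i ∸ 1) (2 * t)       ≡⟨ cong₂ (λ a b → binom₂ (a ∸ 1) b) (2*≡double (suc i)) (2*≡double t) ⟩
    binom₂ (suc (double i)) (double t)   ≡⟨ binom₂-suc-double i t ⟩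
    binom₂ i t                           ∎
    where open ≡-Reasoning

  n/2≡⌊n/2⌋ : ∀ n → n / 2 ≡ ⌊ n /2⌋
  n/2≡⌊n/2⌋ zero          = refl
  n/2≡⌊n/2⌋ (suc zero)    = refl
  n/2≡⌊n/2⌋ (suc (suc n)) = trans (m/n≡1+[m∸n]/n {suc (suc n)} (s≤s (s≤s z≤n))) (cong suc (n/2≡⌊n/2⌋ n))

  ⌊2*t/2⌋≡t : ∀ t → ⌊ 2 * t /2⌋ ≡ t
  ⌊2*t/2⌋≡t t = trans (cong ⌊_/2⌋ (2*≡double t)) (⌊double/2⌋ t)
    where
    ⌊double/2⌋ : ∀ t → ⌊ double t /2⌋ ≡ t
    ⌊double/2⌋ zero    = refl
    ⌊double/2⌋ (suc t) = cong suc (⌊double/2⌋ t)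

  t≤⌊[a+2*t]/2⌋ : ∀ a t → t ≤ ⌊ a + 2 * t /2⌋
  t≤⌊[a+2*t]/2⌋ a t = ≡.subst (_≤ ⌊ a + 2 * t /2⌋) (⌊2*t/2⌋≡t t) (⌊n/2⌋-mono (m≤n+m (2 * t) a))

  n∸s≡j⇒s≡n∸j : ∀ {n s j} → s ≤ n → n ∸ s ≡ j → s ≡ n ∸ j
  n∸s≡j⇒s≡n∸j {n} {s} s≤n n∸s≡j = trans (sym (m∸[m∸n]≡n s≤n)) (cong (n ∸_) n∸s≡j)

  zero∈⊎repeat : ∀ {m} (as : Vec (Fin (suc m)) (suc m)) →
    zero ∈ as ⊎ ∃₂ λ i j → i Fin.< j × lookup as i ≡ lookup as j
  zero∈⊎repeat {m} as with any? (zero Fin.≟_) as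
  ... | yes 0∈as = inj₁ 0∈as
  ... | no  0∉as =
    let i , j , i<j , eq = pigeonhole (n<1+n m) (λ i → Fin.punchOut (0≢ i))
    in inj₂ (i , j , i<j , punchOut-injective (0≢ i) (0≢ j) eq)
    where
    0≢ : ∀ i → ¬ zero ≡ lookup as i
    0≢ i 0≡aᵢ = 0∉as (≡.subst (_∈ as) (sym 0≡aᵢ) (∈-lookup i as))

module BooleanGroup {c ℓ : Level} (B : AbelianGroup c ℓ) (x∙x≈ε : BoolGroup.IsBoolean B) where

  open AbelianGroup B renaming (Carrier to X)
  open BoolGroup B
  open import Relation.Binary.Reasoning.Setoid setoid
  open import Algebra.Properties.CommutativeSemigroup commutativeSemigroup using (interchange)

  x∙y∙y≈x : ∀ x y → (x ∙ y) ∙ y ≈ x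
  x∙y∙y≈x x y = begin
    (x ∙ y) ∙ y  ≈⟨ assoc x y y ⟩
    x ∙ (y ∙ y)  ≈⟨ ∙-congˡ (x∙x≈ε y) ⟩
    x ∙ ε        ≈⟨ identityʳ x ⟩
    x            ∎

  infixr 8 _⊙_

  _⊙_ : Parity → X → X
  0ℙ ⊙ x = ε
  1ℙ ⊙ x = x

  ⊙-congˡ : ∀ p {x y} → x ≈ y → p ⊙ x ≈ p ⊙ y
  ⊙-congˡ 0ℙ _   = refl
  ⊙-congˡ 1ℙ x≈y = x≈y

  ⊙-distrib-∙ : ∀ p x y → p ⊙ (x ∙ y) ≈ p ⊙ x ∙ p ⊙ y
  ⊙-distrib-∙ 0ℙ x y = sym (identityʳ ε)
  ⊙-distrib-∙ 1ℙ x y = refl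

  ⊙-distrib-+ : ∀ p q x → (p ℙ.+ q) ⊙ x ≈ p ⊙ x ∙ q ⊙ x
  ⊙-distrib-+ 0ℙ q  x = sym (identityˡ (q ⊙ x))
  ⊙-distrib-+ 1ℙ 0ℙ x = sym (identityʳ x)
  ⊙-distrib-+ 1ℙ 1ℙ x = sym (x∙x≈ε x)

  ⊙-ε : ∀ p → p ⊙ ε ≈ ε
  ⊙-ε 0ℙ = refl
  ⊙-ε 1ℙ = refl

  ·≈parity⊙ : ∀ n x → n · x ≈ parity n ⊙ x
  ·≈parity⊙ zero          x = refl
  ·≈parity⊙ (suc zero)    x = identityʳ x
  ·≈parity⊙ (suc (suc n)) x = begin
    x ∙ (x ∙ n · x)  ≈⟨ assoc x x (n · x) ⟨
    (x ∙ x) ∙ n · x  ≈⟨ ∙-congʳ (x∙x≈ε x) ⟩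
    ε ∙ n · x        ≈⟨ identityˡ (n · x) ⟩
    n · x            ≈⟨ ·≈parity⊙ n x ⟩
    parity n ⊙ x     ∎

  sumUpTo : ℕ → (ℕ → X) → X
  sumUpTo N f = sumL (applyUpTo f N)

  sumRange≡sumUpTo : ∀ lo hi g → sumRange lo hi g ≡ sumUpTo (suc hi ∸ lo) (λ j → g (lo + j))
  sumRange≡sumUpTo lo hi g = ≡.cong sumL (map-upTo (λ j → g (lo + j)) (suc hi ∸ lo))

  sumUpTo-cong : ∀ N {f g : ℕ → X} → (∀ j → j < N → f j ≈ g j) → sumUpTo N f ≈ sumUpTo N g
  sumUpTo-cong zero    f≈g = refl
  sumUpTo-cong (suc N) f≈g = ∙-cong (f≈g 0 (s≤s z≤n)) (sumUpTo-cong N (λ j j<N → f≈g (suc j) (s≤s j<N)))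

  sumUpTo-ε : ∀ {f : ℕ → X} → (∀ j → f j ≈ ε) → ∀ N → sumUpTo N f ≈ ε
  sumUpTo-ε f≈ε zero    = refl
  sumUpTo-ε f≈ε (suc N) = trans (∙-cong (f≈ε 0) (sumUpTo-ε (λ j → f≈ε (suc j)) N)) (identityˡ ε)

  sumUpTo-∙ : ∀ (f g : ℕ → X) N → sumUpTo N (λ j → f j ∙ g j) ≈ sumUpTo N f ∙ sumUpTo N g
  sumUpTo-∙ f g zero    = sym (identityˡ ε)
  sumUpTo-∙ f g (suc N) = trans (∙-congˡ (sumUpTo-∙ (λ j → f (suc j)) (λ j → g (suc j)) N)) (interchange (f 0) (g 0) _ _)

  sumUpTo-dropZeros : ∀ {a N} {f : ℕ → X} → a ≤ N → (∀ j → j < a → f j ≈ ε) →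
    sumUpTo N f ≈ sumUpTo (N ∸ a) (λ j → f (a + j))
  sumUpTo-dropZeros z≤n       _   = refl
  sumUpTo-dropZeros {suc a} {suc N} {f} (s≤s a≤N) f≈ε = begin
    f 0 ∙ sumUpTo N (λ j → f (suc j))  ≈⟨ ∙-congʳ (f≈ε 0 (s≤s z≤n)) ⟩
    ε ∙ sumUpTo N (λ j → f (suc j))    ≈⟨ identityˡ _ ⟩
    sumUpTo N (λ j → f (suc j))        ≈⟨ sumUpTo-dropZeros a≤N (λ j j<a → f≈ε (suc j) (s≤s j<a)) ⟩
    sumUpTo (N ∸ a) (λ j → f (suc (a + j))) ∎

  sumUpTo-evenOdd : ∀ n (f : ℕ → X) →
    sumUpTo (suc n) f ≈ sumUpTo (suc ⌊ n /2⌋) (λ i → f (double i)) ∙ sumUpTo ⌈ n /2⌉ (λ i → f (suc (double i)))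
  sumUpTo-evenOdd zero          f = sym (identityʳ _)
  sumUpTo-evenOdd (suc zero)    f = ∙-congʳ (sym (identityʳ (f 0)))
  sumUpTo-evenOdd (suc (suc n)) f = begin
    f 0 ∙ (f 1 ∙ sumUpTo (suc n) (λ j → f (suc (suc j))))  ≈⟨ ∙-congˡ (∙-congˡ (sumUpTo-evenOdd n (λ j → f (suc (suc j))))) ⟩
    f 0 ∙ (f 1 ∙ (E ∙ O))                                  ≈⟨ assoc (f 0) (f 1) (E ∙ O) ⟨
    (f 0 ∙ f 1) ∙ (E ∙ O)                                  ≈⟨ interchange (f 0) (f 1) E O ⟩
    (f 0 ∙ E) ∙ (f 1 ∙ O)                                  ∎
    where
    E O : X
    E = sumUpTo (suc ⌊ n /2⌋) (λ i → f (suc (suc (double i))))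
    O = sumUpTo ⌈ n /2⌉ (λ i → f (suc (suc (suc (double i)))))

  sumUpTo-indicator : ∀ {i N} {f : ℕ → X} → i < N → sumUpTo N (λ j → if i ≡ᵇ j then f j else ε) ≈ f i
  sumUpTo-indicator {zero} {suc N} {f} _ = trans (∙-congˡ (sumUpTo-ε (λ _ → refl) N)) (identityʳ (f 0))
  sumUpTo-indicator {suc i} {suc N} (s≤s i<N) = trans (identityˡ _) (sumUpTo-indicator i<N)

  sumL-++ : (xs ys : List X) → sumL (xs ++ ys) ≈ sumL xs ∙ sumL ys
  sumL-++ []       ys = sym (identityˡ (sumL ys))
  sumL-++ (x ∷ xs) ys = trans (∙-congˡ (sumL-++ xs ys)) (sym (assoc x (sumL xs) (sumL ys)))

  module _ {A : Set} where

    sumL-map-cong : ∀ {f g : A → X} → (∀ a → f a ≈ g a) → ∀ as → sumL (map f as) ≈ sumL (map g as)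
    sumL-map-cong f≈g []       = refl
    sumL-map-cong f≈g (a ∷ as) = ∙-cong (f≈g a) (sumL-map-cong f≈g as)

    sumL-map-ε : ∀ {f : A → X} → (∀ a → f a ≈ ε) → ∀ as → sumL (map f as) ≈ ε
    sumL-map-ε f≈ε []       = refl
    sumL-map-ε f≈ε (a ∷ as) = trans (∙-cong (f≈ε a) (sumL-map-ε f≈ε as)) (identityˡ ε)

    sumL-map-∙ : ∀ (f g : A → X) as → sumL (map (λ a → f a ∙ g a) as) ≈ sumL (map f as) ∙ sumL (map g as)
    sumL-map-∙ f g []       = sym (identityˡ ε)
    sumL-map-∙ f g (a ∷ as) = trans (∙-congˡ (sumL-map-∙ f g as)) (interchange (f a) (g a) _ _)

    sumL-map-⊙ : ∀ p (f : A → X) as → sumL (map (λ a → p ⊙ f a) as) ≈ p ⊙ sumL (map f as)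
    sumL-map-⊙ p f []       = sym (⊙-ε p)
    sumL-map-⊙ p f (a ∷ as) = trans (∙-congˡ (sumL-map-⊙ p f as)) (sym (⊙-distrib-∙ p (f a) _))

    sumL-map-fibres : ∀ {N} (w : ℕ → Parity) (h : A → X) (κ : A → ℕ) → (∀ a → κ a < N) → ∀ as →
      sumL (map (λ a → w (κ a) ⊙ h a) as) ≈ sumUpTo N (λ j → w j ⊙ sumL (map h (filterᵇ (λ a → κ a ≡ᵇ j) as)))
    sumL-map-fibres {N} w h κ κ<N []       = sym (sumUpTo-ε (λ j → ⊙-ε (w j)) N)
    sumL-map-fibres {N} w h κ κ<N (a ∷ as) = begin
      w (κ a) ⊙ h a ∙ sumL (map (λ a → w (κ a) ⊙ h a) as)
        ≈⟨ ∙-cong (sym (sumUpTo-indicator (κ<N a))) (sumL-map-fibres w h κ κ<N as) ⟩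
      sumUpTo N (λ j → if κ a ≡ᵇ j then w j ⊙ h a else ε) ∙ sumUpTo N (λ j → w j ⊙ fibre j as)
        ≈⟨ sumUpTo-∙ _ _ N ⟨
      sumUpTo N (λ j → (if κ a ≡ᵇ j then w j ⊙ h a else ε) ∙ w j ⊙ fibre j as)
        ≈⟨ sumUpTo-cong N (λ j _ → split j) ⟨
      sumUpTo N (λ j → w j ⊙ fibre j (a ∷ as))
        ∎
      where
      fibre : ℕ → List A → X
      fibre j bs = sumL (map h (filterᵇ (λ b → κ b ≡ᵇ j) bs))

      split : ∀ j → w j ⊙ fibre j (a ∷ as) ≈ (if κ a ≡ᵇ j then w j ⊙ h a else ε) ∙ w j ⊙ fibre j as
      split j with κ a ≡ᵇ j
      ... | true  = ⊙-distrib-∙ (w j) (h a) (fibre j as)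
      ... | false = sym (identityˡ _)

  -- Weighted sums over subsets and finite differences

  module _ {k : ℕ} where

    weightedSum : (ℕ → Parity) → Vec (Fin k) n → (Subset k → X) → Subset k → X
    weightedSum {n} w x g S = sumL (map (λ I → w ∣ ∁ I ∣ ⊙ g (S △ oddsupp (restrict x I))) (allSubsets n))

    weightedSum-[] : ∀ w g S → weightedSum w [] g S ≈ w 0 ⊙ g (S △ oddsupp [])
    weightedSum-[] w g S = identityʳ _

    weightedSum-∷ : ∀ w a (x : Vec (Fin k) n) g S →
      weightedSum w (a ∷ x) g S ≈ weightedSum (λ j → w (suc j)) x g S ∙ weightedSum w x g (S △ ⁅ a ⁆)
    weightedSum-∷ {n} w a x g S = begin
      sumL (map term (map (outside ∷_) Is ++ map (inside ∷_) Is))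
        ≡⟨ ≡.cong sumL (map-++ term (map (outside ∷_) Is) (map (inside ∷_) Is)) ⟩
      sumL (map term (map (outside ∷_) Is) ++ map term (map (inside ∷_) Is))
        ≈⟨ sumL-++ (map term (map (outside ∷_) Is)) (map term (map (inside ∷_) Is)) ⟩
      sumL (map term (map (outside ∷_) Is)) ∙ sumL (map term (map (inside ∷_) Is))
        ≡⟨ ≡.cong₂ (λ L M → sumL L ∙ sumL M) (≡.sym (map-∘ Is)) (≡.sym (map-∘ Is)) ⟩
      weightedSum (λ j → w (suc j)) x g S ∙ sumL (map (λ I → term (inside ∷ I)) Is)
        ≈⟨ ∙-congˡ (sumL-map-cong (λ I → ⊙-congˡ (w ∣ ∁ I ∣) (reflexive (≡.cong g (toggle I)))) Is) ⟩
      weightedSum (λ j → w (suc j)) x g S ∙ weightedSum w x g (S △ ⁅ a ⁆)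
        ∎
      where
      Is : List (Subset n)
      Is = allSubsets n
      term : Subset (suc n) → X
      term = λ I → w ∣ ∁ I ∣ ⊙ g (S △ oddsupp (restrict (a ∷ x) I))
      toggle : ∀ I → S △ oddsupp (a ∷ restrict x I) ≡ (S △ ⁅ a ⁆) △ oddsupp (restrict x I)
      toggle I = ≡.trans (≡.cong (S △_) (oddsupp-∷ a (restrict x I))) (≡.sym (△-assoc S ⁅ a ⁆ _))

    weightedSum-resp : ∀ {w w′} → (∀ j → w j ≡ w′ j) → ∀ (x : Vec (Fin k) n) g S → weightedSum w x g S ≈ weightedSum w′ x g S
    weightedSum-resp {n} w≡w′ x g S = sumL-map-cong (λ I → reflexive (≡.cong (_⊙ _) (w≡w′ ∣ ∁ I ∣))) (allSubsets n)

    weightedSum-∙ : ∀ w (x : Vec (Fin k) n) g h S →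
      weightedSum w x (λ T → g T ∙ h T) S ≈ weightedSum w x g S ∙ weightedSum w x h S
    weightedSum-∙ {n} w x g h S = trans (sumL-map-cong (λ I → ⊙-distrib-∙ (w ∣ ∁ I ∣) _ _) (allSubsets n)) (sumL-map-∙ _ _ (allSubsets n))

    weightedSum-+ : ∀ w w′ (x : Vec (Fin k) n) g S →
      weightedSum (λ j → w j ℙ.+ w′ j) x g S ≈ weightedSum w x g S ∙ weightedSum w′ x g S
    weightedSum-+ {n} w w′ x g S =
      trans (sumL-map-cong (λ I → ⊙-distrib-+ (w ∣ ∁ I ∣) (w′ ∣ ∁ I ∣) _) (allSubsets n)) (sumL-map-∙ _ _ (allSubsets n))

    weightedSum-translate : ∀ w (x : Vec (Fin k) n) g A S →
      weightedSum w x (λ T → g (T △ A)) S ≈ weightedSum w x g (S △ A)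
    weightedSum-translate {n} w x g A S = sumL-map-cong (λ I → reflexive (≡.cong (λ T → w ∣ ∁ I ∣ ⊙ g T) (△-swapʳ S _ A))) (allSubsets n)

    weightedSum-ε : ∀ w (x : Vec (Fin k) n) {g} → (∀ T → g T ≈ ε) → ∀ S → weightedSum w x g S ≈ ε
    weightedSum-ε {n} w x g≈ε S = sumL-map-ε (λ I → trans (⊙-congˡ (w ∣ ∁ I ∣) (g≈ε _)) (⊙-ε (w ∣ ∁ I ∣))) (allSubsets n)

    weightedSum-0ℙ : ∀ {w} → (∀ j → w j ≡ 0ℙ) → ∀ (x : Vec (Fin k) n) g S → weightedSum w x g S ≈ ε
    weightedSum-0ℙ {n} w≡0 x g S = sumL-map-ε (λ I → reflexive (≡.cong (_⊙ _) (w≡0 ∣ ∁ I ∣))) (allSubsets n)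

    Δ : Fin k → (Subset k → X) → Subset k → X
    Δ a g S = g S ∙ g (S △ ⁅ a ⁆)

    Δ* : ∀ {d} → Vec (Fin k) d → (Subset k → X) → Subset k → X
    Δ* []       g = g
    Δ* (a ∷ as) g = Δ* as (Δ a g)

    HasDegreeBelow : ℕ → (Subset k → X) → Set ℓ
    HasDegreeBelow d g = ∀ (as : Vec (Fin k) d) S → Δ* as g S ≈ ε

    Δ-cong : ∀ a {g h} → (∀ T → g T ≈ h T) → ∀ S → Δ a g S ≈ Δ a h S
    Δ-cong a g≈h S = ∙-cong (g≈h S) (g≈h _)

    Δ*-cong : ∀ {d} (as : Vec (Fin k) d) {g h} → (∀ T → g T ≈ h T) → ∀ S → Δ* as g S ≈ Δ* as h S
    Δ*-cong []       g≈h = g≈h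
    Δ*-cong (a ∷ as) g≈h = Δ*-cong as (Δ-cong a g≈h)

    Δ*-ε : ∀ {d} (as : Vec (Fin k) d) {g} → (∀ T → g T ≈ ε) → ∀ S → Δ* as g S ≈ ε
    Δ*-ε as g≈ε S = trans (Δ*-cong as g≈ε S) (Δ*-ε′ as S)
      where
      Δ*-ε′ : ∀ {d} (as : Vec (Fin k) d) S → Δ* as (λ _ → ε) S ≈ ε
      Δ*-ε′ []       S = refl
      Δ*-ε′ (a ∷ as) S = trans (Δ*-cong as (λ _ → identityˡ ε) S) (Δ*-ε′ as S)

    Δ-comm : ∀ a b g S → Δ a (Δ b g) S ≈ Δ b (Δ a g) S
    Δ-comm a b g S = trans (interchange _ _ _ _) (∙-congˡ (reflexive (≡.cong (λ T → g (S △ ⁅ b ⁆) ∙ g T) (△-swapʳ S ⁅ a ⁆ ⁅ b ⁆))))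

    Δ-self : ∀ a g S → Δ a (Δ a g) S ≈ ε
    Δ-self a g S = begin
      (g S ∙ g (S △ ⁅ a ⁆)) ∙ (g (S △ ⁅ a ⁆) ∙ g ((S △ ⁅ a ⁆) △ ⁅ a ⁆))
        ≡⟨ ≡.cong (λ T → (g S ∙ g (S △ ⁅ a ⁆)) ∙ (g (S △ ⁅ a ⁆) ∙ g T)) (△-cancelʳ S ⁅ a ⁆) ⟩
      (g S ∙ g (S △ ⁅ a ⁆)) ∙ (g (S △ ⁅ a ⁆) ∙ g S)
        ≈⟨ ∙-congˡ (comm _ _) ⟩
      (g S ∙ g (S △ ⁅ a ⁆)) ∙ (g S ∙ g (S △ ⁅ a ⁆))
        ≈⟨ x∙x≈ε _ ⟩
      ε ∎

    Δ*-annihilated : ∀ {d a} {as : Vec (Fin k) d} {g} → a ∈ as → (∀ S → Δ a g S ≈ ε) → ∀ S → Δ* as g S ≈ ε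
    Δ*-annihilated {as = _ ∷ as} (here ≡.refl) Δg≈ε = Δ*-ε as Δg≈ε
    Δ*-annihilated {a = a} {as = b ∷ _} {g} (there a∈as) Δg≈ε = Δ*-annihilated a∈as λ S →
      trans (Δ-comm a b g S) (trans (∙-cong (Δg≈ε S) (Δg≈ε _)) (identityˡ ε))

    Δ*-repeat : ∀ {d} (as : Vec (Fin k) d) {g} {i j : Fin d} → i Fin.< j → lookup as i ≡ lookup as j → ∀ S → Δ* as g S ≈ ε
    Δ*-repeat (a ∷ as) {g} {zero}  {suc j} _         a≡aⱼ = Δ*-annihilated (≡.subst (_∈ as) (≡.sym a≡aⱼ) (∈-lookup j as)) (Δ-self a g)
    Δ*-repeat (a ∷ as) {g} {suc i} {suc j} (s≤s i<j) aᵢ≡aⱼ = Δ*-repeat as i<j aᵢ≡aⱼ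

    weightedSum-Δ : ∀ w (x : Vec (Fin k) n) a g S →
      weightedSum w x g S ≈ weightedSum w x (Δ a g) (S △ ⁅ a ⁆) ∙ weightedSum w x g (S △ ⁅ a ⁆)
    weightedSum-Δ w x a g S = sym (begin
      W (Δ a g) Sa ∙ W g Sa                         ≈⟨ ∙-congʳ (weightedSum-∙ w x g (λ T → g (T △ ⁅ a ⁆)) Sa) ⟩
      (W g Sa ∙ W (λ T → g (T △ ⁅ a ⁆)) Sa) ∙ W g Sa  ≈⟨ ∙-congʳ (∙-congˡ (weightedSum-translate w x g ⁅ a ⁆ Sa)) ⟩
      (W g Sa ∙ W g (Sa △ ⁅ a ⁆)) ∙ W g Sa            ≡⟨ ≡.cong (λ T → (W g Sa ∙ W g T) ∙ W g Sa) (△-cancelʳ S ⁅ a ⁆) ⟩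
      (W g Sa ∙ W g S) ∙ W g Sa                       ≈⟨ ∙-congʳ (comm _ _) ⟩
      (W g S ∙ W g Sa) ∙ W g Sa                       ≈⟨ x∙y∙y≈x _ _ ⟩
      W g S                                           ∎)
      where
      W : (Subset k → X) → Subset k → X
      W = weightedSum w x
      Sa : Subset k
      Sa = S △ ⁅ a ⁆

    -- Weights reproducing the value at oddsupp x

    record Reproduces (d n : ℕ) (w : ℕ → Parity) (e : Parity) : Set (c Level.⊔ ℓ) where
      constructor mkReproduces
      field
        reproduces : ∀ (x : Vec (Fin k) n) g → HasDegreeBelow d g →
          ∀ S → weightedSum w x g S ≈ e ⊙ g (S △ oddsupp (toList x))

    open Reproduces

    reproduces-resp : ∀ {d n w w′ e} → (∀ j → w j ≡ w′ j) → Reproduces d n w e → Reproduces d n w′ e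
    reproduces-resp w≡w′ rep = mkReproduces λ x g deg S → trans (sym (weightedSum-resp w≡w′ x g S)) (reproduces rep x g deg S)

    reproduces-0ℙ : ∀ {d n w} → (∀ j → w j ≡ 0ℙ) → Reproduces d n w 0ℙ
    reproduces-0ℙ w≡0 = mkReproduces λ x g _ S → weightedSum-0ℙ w≡0 x g S

    reproduces-degree0 : ∀ {n w e} → Reproduces 0 n w e
    reproduces-degree0 {w = w} {e} = mkReproduces λ x g deg S →
      trans (weightedSum-ε w x (deg []) S) (sym (trans (⊙-congˡ e (deg [] _)) (⊙-ε e)))

    reproduces-[] : ∀ {d w e} → w 0 ≡ e → Reproduces d 0 w e
    reproduces-[] {w = w} w0≡e = mkReproduces λ where
      [] g _ S → trans (weightedSum-[] w g S) (reflexive (≡.cong (_⊙ _) w0≡e))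

    -- The Δ-expansion of the first term is killed by the second hypothesis.
    reproduces-∷ : ∀ {d n w e} → Reproduces (suc d) n (λ j → w j ℙ.+ w (suc j)) e →
      Reproduces d n (λ j → w (suc j)) 0ℙ → Reproduces (suc d) (suc n) w e
    reproduces-∷ {d} {n} {w} {e} rep₁ rep₀ = mkReproduces step
      where
      step : ∀ (x : Vec (Fin k) (suc n)) g → HasDegreeBelow (suc d) g →
        ∀ S → weightedSum w x g S ≈ e ⊙ g (S △ oddsupp (toList x))
      step (a ∷ x) g deg S = begin
        weightedSum w (a ∷ x) g S
          ≈⟨ weightedSum-∷ w a x g S ⟩
        W₊ g S ∙ W g Sa
          ≈⟨ ∙-congʳ (weightedSum-Δ (λ j → w (suc j)) x a g S) ⟩
        (W₊ (Δ a g) Sa ∙ W₊ g Sa) ∙ W g Sa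
          ≈⟨ ∙-congʳ (∙-congʳ (reproduces rep₀ x (Δ a g) (λ as → deg (a ∷ as)) Sa)) ⟩
        (ε ∙ W₊ g Sa) ∙ W g Sa
          ≈⟨ ∙-congʳ (identityˡ _) ⟩
        W₊ g Sa ∙ W g Sa
          ≈⟨ comm _ _ ⟩
        W g Sa ∙ W₊ g Sa
          ≈⟨ weightedSum-+ w (λ j → w (suc j)) x g Sa ⟨
        weightedSum (λ j → w j ℙ.+ w (suc j)) x g Sa
          ≈⟨ reproduces rep₁ x g deg Sa ⟩
        e ⊙ g (Sa △ oddsupp (toList x))
          ≡⟨ ≡.cong (λ T → e ⊙ g T) (≡.trans (△-assoc S ⁅ a ⁆ _) (≡.cong (S △_) (≡.sym (oddsupp-∷ a (toList x))))) ⟩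
        e ⊙ g (S △ oddsupp (toList (a ∷ x))) ∎
        where
        W W₊ : (Subset k → X) → Subset k → X
        W = weightedSum w x
        W₊ = weightedSum (λ j → w (suc j)) x
        Sa : Subset k
        Sa = S △ ⁅ a ⁆

    reproduces-binom₂ : ∀ n d b c → d + b ≤ n → Reproduces d n (λ j → binom₂ (j + c) b) 0ℙ
    reproduces-binom₂ n       zero    b c _ = reproduces-degree0
    reproduces-binom₂ (suc n) (suc d) b c (s≤s d+b≤n) =
      reproduces-∷ (pascal b d+b≤n) (reproduces-resp shift (reproduces-binom₂ n d b (suc c) d+b≤n))
      where
      shift : ∀ j → binom₂ (j + suc c) b ≡ binom₂ (suc j + c) b
      shift j = ≡.cong (λ m → binom₂ m b) (+-suc j c)

      pascal : ∀ b → d + b ≤ n → Reproduces (suc d) n (λ j → binom₂ (j + c) b ℙ.+ binom₂ (suc j + c) b) 0ℙ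
      pascal zero     _     = reproduces-0ℙ (λ _ → ≡.refl)
      pascal (suc b′) d+b≤n = reproduces-resp (λ j → ≡.sym (x+[y+x]≡y (binom₂ (j + c) (suc b′)) (binom₂ (j + c) b′)))
        (reproduces-binom₂ n (suc d) b′ c (≡.subst (_≤ n) (+-suc d b′) d+b≤n))

    reproduces-binom₂-row0 : ∀ n d → Reproduces d n (binom₂ 0) 1ℙ
    reproduces-binom₂-row0 n       zero    = reproduces-degree0
    reproduces-binom₂-row0 zero    (suc d) = reproduces-[] ≡.refl
    reproduces-binom₂-row0 (suc n) (suc d) =
      reproduces-∷ (reproduces-resp pascal (reproduces-binom₂-row0 n (suc d))) (reproduces-0ℙ (λ _ → ≡.refl))
      where
      pascal : ∀ j → binom₂ 0 j ≡ binom₂ 0 j ℙ.+ binom₂ 0 (suc j)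
      pascal zero    = ≡.refl
      pascal (suc j) = ≡.refl

    reproduces-pascalWeight : ∀ n d b → n ≡ d + b → Reproduces d n (pascalWeight b) 1ℙ
    reproduces-pascalWeight n       zero    b _  = reproduces-degree0
    reproduces-pascalWeight (suc n) (suc d) b eq = reproduces-∷ (pascal b (suc-injective eq))
      (reproduces-resp (λ j → ≡.cong (λ m → binom₂ m b) (+-identityʳ j))
        (reproduces-binom₂ n d b 0 (≤-reflexive (≡.sym (suc-injective eq)))))
      where
      pascal : ∀ b → n ≡ d + b → Reproduces (suc d) n (λ j → pascalWeight b j ℙ.+ pascalWeight b (suc j)) 1ℙ
      pascal zero     _  = reproduces-resp δ (reproduces-binom₂-row0 n (suc d))
        where
        δ : ∀ j → binom₂ 0 j ≡ pascalWeight 0 j ℙ.+ pascalWeight 0 (suc j)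
        δ zero    = ≡.refl
        δ (suc j) = ≡.refl
      pascal (suc b′) eq = reproduces-resp step (reproduces-pascalWeight n (suc d) b′ (≡.trans eq (+-suc d b′)))
        where
        step : ∀ j → pascalWeight b′ j ≡ pascalWeight (suc b′) j ℙ.+ pascalWeight (suc b′) (suc j)
        step zero    = ≡.refl
        step (suc j) = ≡.sym (x+[y+x]≡y (binom₂ j (suc b′)) (binom₂ j b′))

    sizeSum : ℕ → Vec (Fin k) n → (Subset k → X) → Subset k → X
    sizeSum {n} s x g S = sumL (map (λ I → g (S △ oddsupp (restrict x I))) (subsetsOfSize n s))

    sizeSum-· : ∀ (x : Vec (Fin k) n) φ c s →
      sumL (map (λ I → c · φ (oddsupp (restrict x I))) (subsetsOfSize n s)) ≈ parity c ⊙ sizeSum s x φ ⊥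
    sizeSum-· {n} x φ c s = trans
      (sumL-map-cong (λ I → trans (·≈parity⊙ c _) (⊙-congˡ (parity c) (reflexive (≡.cong φ (≡.sym (△-identityˡ _)))))) (subsetsOfSize n s))
      (sumL-map-⊙ (parity c) _ (subsetsOfSize n s))

    weightedSum-bySize : ∀ w (x : Vec (Fin k) n) g S →
      weightedSum w x g S ≈ sumUpTo (suc n) (λ j → w j ⊙ sizeSum (n ∸ j) x g S)
    weightedSum-bySize {n} w x g S =
      trans (sumL-map-fibres w h (λ I → ∣ ∁ I ∣) (λ I → s≤s (∣p∣≤n (∁ I))) (allSubsets n))
            (sumUpTo-cong (suc n) (λ j j<1+n → reflexive (≡.cong (λ Is → w j ⊙ sumL (map h Is)) (fibre≡ (<⇒≤pred j<1+n)))))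
      where
      h : Subset n → X
      h = λ I → g (S △ oddsupp (restrict x I))

      fibre≡ : ∀ {j} → j ≤ n → filterᵇ (λ I → ∣ ∁ I ∣ ≡ᵇ j) (allSubsets n) ≡ subsetsOfSize n (n ∸ j)
      fibre≡ {j} j≤n = filter-≐ (λ I → T? (∣ ∁ I ∣ ≡ᵇ j)) (λ I → T? (∣ I ∣ ≡ᵇ n ∸ j)) ((λ {I} → to I) , (λ {I} → from I)) (allSubsets n)
        where
        to : ∀ I → T (∣ ∁ I ∣ ≡ᵇ j) → T (∣ I ∣ ≡ᵇ n ∸ j)
        to I eq = ≡⇒≡ᵇ ∣ I ∣ (n ∸ j) (n∸s≡j⇒s≡n∸j (∣p∣≤n I) (≡.trans (≡.sym (∣∁p∣≡n∸∣p∣ I)) (≡ᵇ⇒≡ ∣ ∁ I ∣ j eq)))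

        from : ∀ I → T (∣ I ∣ ≡ᵇ n ∸ j) → T (∣ ∁ I ∣ ≡ᵇ j)
        from I eq = ≡⇒≡ᵇ ∣ ∁ I ∣ j (≡.trans (∣∁p∣≡n∸∣p∣ I) (≡.sym (n∸s≡j⇒s≡n∸j j≤n (≡.sym (≡ᵇ⇒≡ ∣ I ∣ (n ∸ j) eq)))))

  invariant0⇒hasDegreeBelow : ∀ {m} {g : Subset (suc m) → X} → Invariant0 g → HasDegreeBelow (suc m) g
  invariant0⇒hasDegreeBelow {g = g} inv as with zero∈⊎repeat as
  ... | inj₁ 0∈as                = Δ*-annihilated 0∈as (λ S → trans (∙-congˡ (sym (inv S))) (x∙x≈ε (g S)))
  ... | inj₂ (_ , _ , i<j , eq) = Δ*-repeat as i<j eq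

  module _ {m n : ℕ} (t : ℕ) (x : Vec (Fin (suc m)) n) (φ : Subset (suc m) → X) where

    term : ℕ → X
    term j = pascalWeight (2 * t) j ⊙ sizeSum (n ∸ j) x φ ⊥

    evenSummand oddSummand : ℕ → X
    evenSummand i = sumL (map (λ I → ((i ∸ 1) C t) · φ (oddsupp (restrict x I))) (subsetsOfSize n (n ∸ 2 * i)))
    oddSummand k = sumL (map (λ K → ((2 * k ∸ 1) C (2 * t)) · φ (oddsupp (restrict x K))) (subsetsOfSize n (n + 1 ∸ 2 * k)))

    evenTerms≈ : t ≤ ⌊ n /2⌋ → sumUpTo (suc ⌊ n /2⌋) (λ i → term (double i)) ≈ sumRange (suc t) (n / 2) evenSummand
    evenTerms≈ t≤⌊n/2⌋ = begin
      sumUpTo (suc ⌊ n /2⌋) (λ i → term (double i))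
        ≈⟨ sumUpTo-dropZeros (s≤s t≤⌊n/2⌋) vanish ⟩
      sumUpTo (⌊ n /2⌋ ∸ t) (λ j → term (double (suc t + j)))
        ≈⟨ sumUpTo-cong (⌊ n /2⌋ ∸ t) (λ j _ → coefficient (t + j)) ⟩
      sumUpTo (⌊ n /2⌋ ∸ t) (λ j → evenSummand (suc t + j))
        ≡⟨ ≡.cong (λ N → sumUpTo (N ∸ t) (λ j → evenSummand (suc t + j))) (n/2≡⌊n/2⌋ n) ⟨
      sumUpTo (n / 2 ∸ t) (λ j → evenSummand (suc t + j))
        ≡⟨ sumRange≡sumUpTo (suc t) (n / 2) evenSummand ⟨
      sumRange (suc t) (n / 2) evenSummand ∎
      where
      vanish : ∀ i → i < suc t → term (double i) ≈ ε
      vanish zero    _         = refl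
      vanish (suc i) (s≤s i<t) = reflexive (≡.cong (_⊙ _) (≡.trans (pascalWeight-double t i) (binom₂-< i<t)))

      coefficient : ∀ i → term (double (suc i)) ≈ evenSummand (suc i)
      coefficient i = begin
        term (double (suc i))
          ≡⟨ ≡.cong₂ (λ p s → p ⊙ sizeSum s x φ ⊥)
               (≡.trans (pascalWeight-double t i) (≡.sym (parity-C i t)))
               (≡.cong (n ∸_) (≡.sym (2*≡double (suc i)))) ⟩
        parity (i C t) ⊙ sizeSum (n ∸ 2 * suc i) x φ ⊥
          ≈⟨ sizeSum-· x φ (i C t) (n ∸ 2 * suc i) ⟨
        evenSummand (suc i) ∎

    oddTerms≈ : t ≤ ⌈ n /2⌉ → sumUpTo ⌈ n /2⌉ (λ i → term (suc (double i))) ≈ sumRange (suc t) ((n + 1) / 2) oddSummand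
    oddTerms≈ t≤⌈n/2⌉ = begin
      sumUpTo ⌈ n /2⌉ (λ i → term (suc (double i)))
        ≈⟨ sumUpTo-dropZeros t≤⌈n/2⌉ vanish ⟩
      sumUpTo (⌈ n /2⌉ ∸ t) (λ j → term (suc (double (t + j))))
        ≈⟨ sumUpTo-cong (⌈ n /2⌉ ∸ t) (λ j _ → coefficient (t + j)) ⟩
      sumUpTo (⌈ n /2⌉ ∸ t) (λ j → oddSummand (suc t + j))
        ≡⟨ ≡.cong (λ N → sumUpTo (N ∸ t) (λ j → oddSummand (suc t + j))) ⌈n/2⌉≡[n+1]/2 ⟩
      sumUpTo ((n + 1) / 2 ∸ t) (λ j → oddSummand (suc t + j))
        ≡⟨ sumRange≡sumUpTo (suc t) ((n + 1) / 2) oddSummand ⟨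
      sumRange (suc t) ((n + 1) / 2) oddSummand ∎
      where
      ⌈n/2⌉≡[n+1]/2 : ⌈ n /2⌉ ≡ (n + 1) / 2
      ⌈n/2⌉≡[n+1]/2 = ≡.trans (≡.sym (n/2≡⌊n/2⌋ (suc n))) (≡.cong (_/ 2) (+-comm 1 n))

      vanish : ∀ i → i < t → term (suc (double i)) ≈ ε
      vanish i i<t = reflexive (≡.cong (_⊙ _) (≡.trans (pascalWeight-suc-double t i) (binom₂-< i<t)))

      coefficient : ∀ i → term (suc (double i)) ≈ oddSummand (suc i)
      coefficient i = begin
        term (suc (double i))
          ≡⟨ ≡.cong₂ (λ p s → p ⊙ sizeSum s x φ ⊥)
               (≡.trans (pascalWeight-suc-double t i) (≡.sym (parity-C-odd i t)))
               (≡.cong₂ _∸_ (+-comm 1 n) (≡.sym (2*≡double (suc i)))) ⟩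
        parity ((2 * suc i ∸ 1) C (2 * t)) ⊙ sizeSum (n + 1 ∸ 2 * suc i) x φ ⊥
          ≈⟨ sizeSum-· x φ ((2 * suc i ∸ 1) C (2 * t)) (n + 1 ∸ 2 * suc i) ⟨
        oddSummand (suc i) ∎

    formula≈weightedSum : t ≤ ⌊ n /2⌋ → formula n t φ x ≈ weightedSum (pascalWeight (2 * t)) x φ ⊥
    formula≈weightedSum t≤⌊n/2⌋ = sym (begin
      weightedSum (pascalWeight (2 * t)) x φ ⊥  ≈⟨ weightedSum-bySize (pascalWeight (2 * t)) x φ ⊥ ⟩
      sumUpTo (suc n) term                      ≈⟨ sumUpTo-evenOdd n term ⟩
      sumUpTo (suc ⌊ n /2⌋) (λ i → term (double i)) ∙ sumUpTo ⌈ n /2⌉ (λ i → term (suc (double i)))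
        ≈⟨ ∙-cong (evenTerms≈ t≤⌊n/2⌋) (oddTerms≈ (≤-trans t≤⌊n/2⌋ (⌊n/2⌋≤⌈n/2⌉ n))) ⟩
      formula n t φ x                           ∎)

  invariant0-tail : ∀ {m} {g : Subset (suc m) → X} → Invariant0 g → ∀ S T → tail S ≡ tail T → g S ≈ g T
  invariant0-tail inv (true  ∷ R) (true  ∷ R) ≡.refl = refl
  invariant0-tail inv (false ∷ R) (false ∷ R) ≡.refl = refl
  invariant0-tail {g = g} inv (true  ∷ R) (false ∷ R) ≡.refl =
    trans (inv (true ∷ R)) (reflexive (≡.cong (λ T → g (false ∷ T)) (△-identityʳ R)))
  invariant0-tail {g = g} inv (false ∷ R) (true  ∷ R) ≡.refl =
    trans (inv (false ∷ R)) (reflexive (≡.cong (λ T → g (true ∷ T)) (△-identityʳ R)))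

  formula≈oddsupp : ∀ {m} t (x : Vec (Fin (suc m)) (suc m + 2 * t)) φ → Invariant0 φ →
    formula (suc m + 2 * t) t φ x ≈ φ (oddsupp (toList x))
  formula≈oddsupp {m} t x φ inv = begin
    formula (suc m + 2 * t) t φ x
      ≈⟨ formula≈weightedSum t x φ (t≤⌊[a+2*t]/2⌋ (suc m) t) ⟩
    weightedSum (pascalWeight (2 * t)) x φ ⊥
      ≈⟨ Reproduces.reproduces (reproduces-pascalWeight _ (suc m) (2 * t) ≡.refl) x φ (invariant0⇒hasDegreeBelow inv) ⊥ ⟩
    φ (⊥ △ oddsupp (toList x))
      ≡⟨ ≡.cong φ (△-identityˡ _) ⟩
    φ (oddsupp (toList x)) ∎

  module _ {m : ℕ} (t : ℕ) (f : Vec (Fin (suc m)) (suc m + 2 * t) → X) where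

    formula⇒determinedByOddsupp :
      Σ (Subset (suc m) → X) (λ φ → Invariant0 φ × ∀ x → f x ≈ formula (suc m + 2 * t) t φ x) → DeterminedByOddsupp f
    formula⇒determinedByOddsupp (φ , inv , f≈formula) = φ , λ x → trans (f≈formula x) (formula≈oddsupp t x φ inv)

    determinedByOddsupp⇒formula :
      DeterminedByOddsupp f → Σ (Subset (suc m) → X) (λ φ → Invariant0 φ × ∀ x → f x ≈ formula (suc m + 2 * t) t φ x)
    determinedByOddsupp⇒formula (ψ , f≈ψ) = φ , inv , λ x → begin
      f x                     ≈⟨ f≈ψ x ⟩
      ψ (oddsupp (toList x))  ≡⟨ invariantExtension-agrees (parity (suc m + 2 * t)) ψ _ (parity-∣oddsupp∣ x) ⟨
      φ (oddsupp (toList x))  ≈⟨ formula≈oddsupp t x φ inv ⟨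
      formula _ t φ x         ∎
      where
      φ : Subset (suc m) → X
      φ = invariantExtension (parity (suc m + 2 * t)) ψ

      inv : Invariant0 φ
      inv S = reflexive (≡.sym (invariantExtension-△⁅0⁆ _ ψ S))

    formula-unique : ∀ φ ψ → Invariant0 φ → (∀ x → f x ≈ formula (suc m + 2 * t) t φ x) →
      Invariant0 ψ → (∀ x → f x ≈ formula (suc m + 2 * t) t ψ x) → ∀ S → φ S ≈ ψ S
    formula-unique φ ψ invφ f≈φ invψ f≈ψ S = begin
      φ S              ≈⟨ invariant0-tail invφ S O (≡.sym tail-O) ⟩
      φ O              ≈⟨ formula≈oddsupp t x φ invφ ⟨
      formula _ t φ x  ≈⟨ f≈φ x ⟨
      f x              ≈⟨ f≈ψ x ⟩
      formula _ t ψ x  ≈⟨ formula≈oddsupp t x ψ invψ ⟩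
      ψ O              ≈⟨ invariant0-tail invψ O S tail-O ⟩
      ψ S              ∎
      where
      x : Vec (Fin (suc m)) (suc m + 2 * t)
      x = zero ∷ (spell (tail S) Vec.++ replicate (2 * t) zero)
      O : Subset (suc m)
      O = oddsupp (toList x)

      tail-O : tail O ≡ tail S
      tail-O = tail-oddsupp-witness (2 * t) (tail S)


theorem4p2 : {c ℓ : Level} (B : AbelianGroup c ℓ) →
    BoolGroup.IsBoolean B → BoolGroup.IsFinite B →
    (m n t : ℕ) → 1 ≤ n → 1 ≤ t → n ≡ suc m + 2 * t →
    (f : Vec (Fin (suc m)) n → AbelianGroup.Carrier B) →
    (BoolGroup.DeterminedByOddsupp B f ⇔
      Σ (Subset (suc m) → AbelianGroup.Carrier B) (λ φ →
        BoolGroup.Invariant0 B φ ×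
        (∀ x → AbelianGroup._≈_ B (f x) (BoolGroup.formula B n t φ x))))
    ×
    ((φ ψ : Subset (suc m) → AbelianGroup.Carrier B) →
      BoolGroup.Invariant0 B φ →
      (∀ x → AbelianGroup._≈_ B (f x) (BoolGroup.formula B n t φ x)) →
      BoolGroup.Invariant0 B ψ →
      (∀ x → AbelianGroup._≈_ B (f x) (BoolGroup.formula B n t ψ x)) →
      ∀ S → AbelianGroup._≈_ B (φ S) (ψ S))
theorem4p2 B x∙x≈ε _ m n t _ _ ≡.refl f =
  mk⇔ (determinedByOddsupp⇒formula t f) (formula⇒determinedByOddsupp t f) , formula-unique t f
  where open BooleanGroup B x∙x≈ε
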